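{- Let $G$ be a connected finite simple graph with $|E_G|\ge 2$. If there is a vertex $v\in V_G$ that is not contained in any triangle (subgraph isomorphic to $C_3$) of $G$, then $G$ has a NAC-coloring.
   Context: A coloring $\delta\colon E_G\to\{\text{blue},\text{red}\}$ is a NAC-coloring if it is surjective and $G$ contains no cycle with exactly one blue edge and no cycle with exactly one red edge. -}

module Defs where

open import Data.Nat using (ℕ; zero; suc; _+_)
open import Data.Fin using (Fin; zero; suc; inject₁; fromℕ)
open import Data.Bool using (Bool; true; false; T)
open import Data.Product using (Σ; ∃; ∃-syntax; _×_; _,_)
open import Data.Sum using (_⊎_)
open import Relation.Binary.PropositionalEquality using (_≡_)
open import Relation.Nullary using (¬_)
open import Function.Definitions using (Injective)

record Graph (n : ℕ) : Set where
  field
    adj     : Fin n → Fin n → Bool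
    symm    : ∀ u v → adj u v ≡ adj v u
    irrefl  : ∀ v → adj v v ≡ false
open Graph public

-- u v is an edge (proof-irrelevant, since T b has at most one element)
Edge : ∀ {n} → Graph n → Fin n → Fin n → Set
Edge G u v = T (adj G u v)

record Walk {n} (G : Graph n) (u v : Fin n) : Set where
  field
    len   : ℕ
    vtx   : Fin (suc len) → Fin n
    start : vtx zero ≡ u
    end   : vtx (fromℕ len) ≡ v
    step  : ∀ (i : Fin len) → Edge G (vtx (inject₁ i)) (vtx (suc i))

Connected : ∀ {n} → Graph n → Set
Connected G = ∀ u v → Walk G u v

AtLeastTwoEdges : ∀ {n} → Graph n → Set
AtLeastTwoEdges G =
  ∃[ a ] ∃[ b ] ∃[ c ] ∃[ d ]
    (Edge G a b × Edge G c d ×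
     ¬ ((a ≡ c × b ≡ d) ⊎ (a ≡ d × b ≡ c)))

-- v lies in a triangle (in a simple graph the three vertices are
-- automatically distinct)
InTriangle : ∀ {n} → Graph n → Fin n → Set
InTriangle G v = ∃[ u ] ∃[ w ] (Edge G v u × Edge G u w × Edge G w v)

data Color : Set where
  blue red : Color

record Coloring {n} (G : Graph n) : Set where
  field
    col     : ∀ u v → Edge G u v → Color
    col-sym : ∀ u v (e : Edge G u v) (e' : Edge G v u) → col u v e ≡ col v u e'
open Coloring public

-- A cycle of length m+3: vertices c 0,…,c (m+3) with c 0 = c (m+3),
-- c 0,…,c (m+2) pairwise distinct, consecutive ones adjacent.
record Cycle {n} (G : Graph n) : Set where
  field
    m      : ℕ
    c      : Fin (suc (3 + m)) → Fin n
    closed : c zero ≡ c (fromℕ (3 + m))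
    inj    : Injective _≡_ _≡_ (λ (i : Fin (3 + m)) → c (inject₁ i))
    step   : ∀ (i : Fin (3 + m)) → Edge G (c (inject₁ i)) (c (suc i))
open Cycle public

countTrue : ∀ {k} → (Fin k → Bool) → ℕ
countTrue {zero}  f = 0
countTrue {suc k} f with f zero
... | true  = suc (countTrue (λ i → f (suc i)))
... | false = countTrue (λ i → f (suc i))

isColor : Color → Color → Bool
isColor blue blue = true
isColor red  red  = true
isColor _    _    = false

countColor : ∀ {n} {G : Graph n} → Coloring G → Cycle G → Color → ℕ
countColor δ C a =
  countTrue (λ i → isColor a (col δ _ _ (step C i)))

IsNAC : ∀ {n} {G : Graph n} → Coloring G → Set
IsNAC {G = G} δ =
  (∃[ u ] ∃[ v ] Σ (Edge G u v) λ e → col δ u v e ≡ blue) ×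
  (∃[ u ] ∃[ v ] Σ (Edge G u v) λ e → col δ u v e ≡ red) ×
  (∀ (C : Cycle G) → ¬ (countColor δ C blue ≡ 1)) ×
  (∀ (C : Cycle G) → ¬ (countColor δ C red ≡ 1))

HasNAC : ∀ {n} → Graph n → Set
HasNAC G = Σ (Coloring G) IsNAC

module Submission where

-- Proof idea.  Let v be a vertex lying in no triangle.
--
-- * If some edge xy avoids v, colour the edges at v red and all other
--   edges blue.  Both colours occur (xy is blue; by connectivity v has an
--   edge, which is red).  A cycle through v uses exactly two edges at v,
--   so no cycle has exactly one red edge; and a cycle all of whose edges
--   but one pass through v is a triangle through v, which does not exist,
--   so no cycle has exactly one blue edge.
-- * Otherwise every edge contains v, so by the same triangle argument G
--   has no cycle at all, and any colouring using both colours is a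
--   NAC-colouring: we colour one of the two given edges red, the rest blue.

open import Defs
open import Data.Nat using (ℕ; zero; suc; _+_)
open import Data.Nat.Properties using (suc-injective; 1+n≢n; <⇒≢; n<1+n; m<n⇒m<1+n)
open import Data.Fin using (Fin; zero; suc; inject₁; fromℕ; toℕ; _≟_)
open import Data.Fin.Properties using (toℕ-inject₁; any?)
open import Data.Bool using (Bool; true; false)
open import Data.Product using (Σ; ∃-syntax; _×_; _,_)
open import Data.Sum using (_⊎_; inj₁; inj₂)
open import Data.Empty using (⊥-elim)
open import Function using (_∘_)
open import Relation.Binary.PropositionalEquality
  using (_≡_; _≢_; refl; sym; trans; cong; subst)
open import Relation.Nullary using (¬_; Dec; yes; no)
open import Relation.Nullary.Decidable using (T?; ¬?; _×-dec_; _⊎-dec_)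

prev : ∀ {k} → Fin (suc k) → Fin (suc k)
prev {k} zero = fromℕ k
prev (suc j) = inject₁ j

-- inject₁ j and suc j have the values toℕ j and 1 + toℕ j.
suc≢inject₁ : ∀ {k} (j : Fin k) → suc j ≢ inject₁ j
suc≢inject₁ j e = 1+n≢n (trans (cong toℕ e) (toℕ-inject₁ j))

prev-moves : ∀ {k} (i : Fin (suc (suc k))) → prev i ≢ i
prev-moves zero ()
prev-moves (suc j) e = suc≢inject₁ j (sym e)

prev²-moves : ∀ {k} (i : Fin (suc (suc (suc k)))) → prev (prev i) ≢ i
prev²-moves zero ()
prev²-moves (suc zero) ()
prev²-moves (suc (suc j)) e =
  <⇒≢ (m<n⇒m<1+n (n<1+n (toℕ j)))
      (trans (sym (trans (toℕ-inject₁ (inject₁ j)) (toℕ-inject₁ j))) (cong toℕ e))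

lastOrInject₁ : ∀ {k} (i : Fin (suc k)) → i ≡ fromℕ k ⊎ ∃[ j ] i ≡ inject₁ j
lastOrInject₁ {zero} zero = inj₁ refl
lastOrInject₁ {suc k} zero = inj₂ (zero , refl)
lastOrInject₁ {suc k} (suc i) with lastOrInject₁ i
... | inj₁ e = inj₁ (cong suc e)
... | inj₂ (j , e) = inj₂ (suc j , cong suc e)

countTrue-zero : ∀ {k} (f : Fin k → Bool) → countTrue f ≡ 0 → ∀ j → f j ≡ false
countTrue-zero {suc k} f h j with f zero in f0
countTrue-zero {suc k} f h zero | false = f0
countTrue-zero {suc k} f h (suc j) | false = countTrue-zero (f ∘ suc) h j

countTrue-one : ∀ {k} (f : Fin k → Bool) → countTrue f ≡ 1 →
  ∃[ i ] f i ≡ true × (∀ j → j ≢ i → f j ≡ false)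
countTrue-one {suc k} f h with f zero in f0
... | true = zero , f0 , λ
  { zero 0≢0 → ⊥-elim (0≢0 refl)
  ; (suc j) _ → countTrue-zero (f ∘ suc) (suc-injective h) j }
... | false with countTrue-one (f ∘ suc) h
... | i , fi , others = suc i , fi , λ
  { zero _ → f0
  ; (suc j) j≢i → others j (j≢i ∘ cong suc) }

isColor-true : ∀ a b → isColor a b ≡ true → b ≡ a
isColor-true blue blue _ = refl
isColor-true red red _ = refl

isColor-false : ∀ a b → isColor a b ≡ false → b ≢ a
isColor-false blue blue () refl
isColor-false red red () refl

uniqueColoured : ∀ {n} {G : Graph n} (δ : Coloring G) (C : Cycle G) (a : Color) →
  countColor δ C a ≡ 1 →
  ∃[ i ] col δ _ _ (step C i) ≡ a × (∀ j → j ≢ i → col δ _ _ (step C j) ≢ a)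
uniqueColoured δ C a h with countTrue-one _ h
... | i , fi , others =
  i , isColor-true a _ fi , λ j j≢i → isColor-false a _ (others j j≢i)

Incident : ∀ {n} → Fin n → Fin n → Fin n → Set
Incident v x y = x ≡ v ⊎ y ≡ v

incident? : ∀ {n} (v x y : Fin n) → Dec (Incident v x y)
incident? v x y = (x ≟ v) ⊎-dec (y ≟ v)

incident-sym : ∀ {n} {v x y : Fin n} → Incident v x y → Incident v y x
incident-sym (inj₁ e) = inj₂ e
incident-sym (inj₂ e) = inj₁ e

-- Positions of a cycle are Fin (3 + m); edge i runs from position i to
-- the vertex c (suc i).
module OnCycle {n} {G : Graph n} (C : Cycle G) (v : Fin n) where

  pos : Fin (3 + m C) → Fin n
  pos p = c C (inject₁ p)

  Hits : Fin (3 + m C) → Set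
  Hits i = Incident v (pos i) (c C (suc i))

  arrive : ∀ p → c C (suc (prev p)) ≡ pos p
  arrive zero = sym (closed C)
  arrive (suc j) = refl

  edgeInto : ∀ p → Edge G (pos (prev p)) (pos p)
  edgeInto p = subst (Edge G (pos (prev p))) (arrive p) (step C (prev p))

  endpoint : ∀ i → ∃[ p ] c C (suc i) ≡ pos p
  endpoint i with lastOrInject₁ i
  ... | inj₁ refl = zero , sym (closed C)
  ... | inj₂ (j , refl) = suc j , refl

  onlyAt : ∀ {p} → pos p ≡ v → ∀ q → q ≢ p → pos q ≢ v
  onlyAt pv q q≢p qv = q≢p (inj C (trans qv (sym pv)))

  hitsOnCycle : ∀ i → Hits i → ∃[ p ] pos p ≡ v
  hitsOnCycle i (inj₁ e) = i , e
  hitsOnCycle i (inj₂ e) with endpoint i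
  ... | p , q = p , trans (sym q) e

  -- v never lies on exactly one edge of a cycle: the edges leaving and
  -- entering its position both contain it.
  hitsAnother : ∀ i → Hits i → ∃[ j ] j ≢ i × Hits j
  hitsAnother i h with hitsOnCycle i h
  ... | p , pv with p ≟ i
  ... | yes refl = prev p , prev-moves p , inj₂ (trans (arrive p) pv)
  ... | no p≢i = p , p≢i , inj₁ pv

  -- With v at position p, q = prev p and r = prev q, edge r
  -- misses v, hence r = i; so edge prev r contains v, forcing prev r = p,
  -- and p, r, q form a triangle.
  triangle : ∀ i → (∀ j → j ≢ i → Hits j) → InTriangle G v
  triangle i others with hitsOnCycle (prev i) (others (prev i) (prev-moves i))
  ... | p , pv = pos r , pos q , edgeFromV , edgeInto q ,
                 subst (Edge G (pos q)) pv (edgeInto p)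
    where
    q r : Fin (3 + m C)
    q = prev p
    r = prev q

    qv : pos q ≢ v
    qv = onlyAt pv q (prev-moves p)

    rv : pos r ≢ v
    rv = onlyAt pv r (prev²-moves p)

    r≡i : r ≡ i
    r≡i with r ≟ i
    ... | yes e = e
    ... | no r≢i with others r r≢i
    ...   | inj₁ e = ⊥-elim (rv e)
    ...   | inj₂ e = ⊥-elim (qv (trans (sym (arrive q)) e))

    prevRv : pos (prev r) ≡ v
    prevRv with others (prev r) (λ e → prev-moves r (trans e (sym r≡i)))
    ... | inj₁ e = e
    ... | inj₂ e = ⊥-elim (rv (trans (sym (arrive r)) e))

    edgeFromV : Edge G v (pos r)
    edgeFromV = subst (λ x → Edge G x (pos r)) prevRv (edgeInto r)

noCycle : ∀ {n} {G : Graph n} (v : Fin n) → ¬ InTriangle G v →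
  (∀ x y → Edge G x y → Incident v x y) → ¬ Cycle G
noCycle v hv star C = hv (triangle zero (λ j _ → star _ _ (step C j)))
  where open OnCycle C v

module ColourBy {n} (G : Graph n) {R : Fin n → Fin n → Set}
                (R? : ∀ x y → Dec (R x y)) (R-sym : ∀ {x y} → R x y → R y x) where

  colour : Fin n → Fin n → Color
  colour x y with R? x y
  ... | yes _ = red
  ... | no _ = blue

  colour-sym : ∀ x y → colour x y ≡ colour y x
  colour-sym x y with R? x y | R? y x
  ... | yes _ | yes _ = refl
  ... | no _ | no _ = refl
  ... | yes r | no ¬r = ⊥-elim (¬r (R-sym r))
  ... | no ¬r | yes r = ⊥-elim (¬r (R-sym r))

  δ : Coloring G
  δ = record { col = λ x y _ → colour x y ; col-sym = λ x y _ _ → colour-sym x y }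

  red-if : ∀ {x y} → R x y → colour x y ≡ red
  red-if {x} {y} r with R? x y
  ... | yes _ = refl
  ... | no ¬r = ⊥-elim (¬r r)

  blue-if : ∀ {x y} → ¬ R x y → colour x y ≡ blue
  blue-if {x} {y} ¬r with R? x y
  ... | yes r = ⊥-elim (¬r r)
  ... | no _ = refl

  R-if-notBlue : ∀ {x y} → colour x y ≢ blue → R x y
  R-if-notBlue {x} {y} h with R? x y
  ... | yes r = r
  ... | no _ = ⊥-elim (h refl)

  ¬R-if-notRed : ∀ {x y} → colour x y ≢ red → ¬ R x y
  ¬R-if-notRed h = h ∘ red-if

  R-if-red : ∀ {x y} → colour x y ≡ red → R x y
  R-if-red e = R-if-notBlue (λ e' → redNotBlue (trans (sym e) e'))
    where
    redNotBlue : red ≢ blue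
    redNotBlue ()

avoidingEdgeNAC : ∀ {n} (G : Graph n) → Connected G → (v : Fin n) → ¬ InTriangle G v →
  ∀ x y → Edge G x y → ¬ Incident v x y → HasNAC G
avoidingEdgeNAC G conn v hv x y xy avoid =
  δ , (x , y , xy , blue-if avoid) , redEdge (conn v x) ,
  noSingleBlue , noSingleRed
  where
  open ColourBy G (incident? v) incident-sym

  -- the first edge of a walk from v to x ≠ v is at v, hence red
  redEdge : Walk G v x → ∃[ u ] ∃[ w ] Σ (Edge G u w) λ e → colour u w ≡ red
  redEdge W with Walk.len W | Walk.vtx W | Walk.start W | Walk.end W | Walk.step W
  ... | zero | _ | refl | x≡v | _ = ⊥-elim (avoid (inj₁ (sym x≡v)))
  ... | suc _ | vtx | refl | _ | stp = vtx zero , vtx (suc zero) , stp zero , red-if (inj₁ refl)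

  noSingleRed : ∀ C → ¬ countColor δ C red ≡ 1
  noSingleRed C h with uniqueColoured δ C red h
  ... | i , iRed , others with hitsAnother i (R-if-red iRed)
    where open OnCycle C v
  ... | j , j≢i , hj = ¬R-if-notRed (others j j≢i) hj

  noSingleBlue : ∀ C → ¬ countColor δ C blue ≡ 1
  noSingleBlue C h with uniqueColoured δ C blue h
  ... | i , _ , others = hv (triangle i (λ j j≢i → R-if-notBlue (others j j≢i)))
    where open OnCycle C v

SameEdge : ∀ {n} → Fin n → Fin n → Fin n → Fin n → Set
SameEdge a b x y = (a ≡ x × b ≡ y) ⊎ (a ≡ y × b ≡ x)

sameEdge? : ∀ {n} (a b x y : Fin n) → Dec (SameEdge a b x y)
sameEdge? a b x y = ((a ≟ x) ×-dec (b ≟ y)) ⊎-dec ((a ≟ y) ×-dec (b ≟ x))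

sameEdge-sym : ∀ {n} {a b x y : Fin n} → SameEdge a b x y → SameEdge a b y x
sameEdge-sym (inj₁ (e , e')) = inj₂ (e , e')
sameEdge-sym (inj₂ (e , e')) = inj₁ (e , e')

starNAC : ∀ {n} (G : Graph n) → AtLeastTwoEdges G → (v : Fin n) → ¬ InTriangle G v →
  (∀ x y → Edge G x y → Incident v x y) → HasNAC G
starNAC G (a , b , a' , b' , ab , a'b' , distinct) v hv star =
  δ , (a' , b' , a'b' , blue-if distinct) , (a , b , ab , red-if (inj₁ (refl , refl))) ,
  (λ C _ → noCycle v hv star C) , (λ C _ → noCycle v hv star C)
  where
  open ColourBy G (sameEdge? a b) sameEdge-sym

corollary1 : ∀ {n : ℕ} (G : Graph n) → Connected G → AtLeastTwoEdges G →
    (∃[ v ] ¬ InTriangle G v) → HasNAC G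
corollary1 G conn twoEdges (v , hv)
  with any? (λ x → any? (λ y → T? (adj G x y) ×-dec ¬? (incident? v x y)))
... | yes (x , y , xy , avoid) = avoidingEdgeNAC G conn v hv x y xy avoid
... | no noAvoiding = starNAC G twoEdges v hv star
  where
  star : ∀ x y → Edge G x y → Incident v x y
  star x y xy with incident? v x y
  ... | yes inc = inc
  ... | no avoid = ⊥-elim (noAvoiding (x , y , xy , avoid))
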